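{- Let $\mathcal{I}$ be an Alternating pushdown system, let $\hat{\mathcal{I}}$ be the system obtained from $\mathcal{I}$ by replacing each rule whose conclusion has the form $P(x)$ by its instance with $x:=\varepsilon$ and, for each function symbol $a$, its instance with $x:=a\,x$, and let $\mathcal{C}$ be a finite set of atomic propositions such that the conclusions of the rules of $\hat{\mathcal{I}}$ are in $\mathcal{C}$ and every closed atomic proposition is an instance of a unique element of $\mathcal{C}$. Let $\mathcal{J}$ be the system defined as follows: for each $B\in\mathcal{C}$, if $r^B_1,\dots,r^B_n$ ($n\ge0$) are the rules of $\hat{\mathcal{I}}$ with conclusion $B$, the rule $r^B_i$ having premises $A^i_1,\dots,A^i_{m_i}$ ($m_i\ge0$), then $\mathcal{J}$ contains the $m_1\times\cdots\times m_n$ rules with conclusion $B$ and premises $A^1_{j_1},\dots,A^n_{j_n}$ ($1\le j_i\le m_i$). Then for each closed proposition $B$, if $\langle A^1_1,\dots,A^1_{n_1}\rangle,\dots,\langle A^p_1,\dots,A^p_{n_p}\rangle$ are all the sequences of premises from which $B$ is derivable in $\hat{\mathcal{I}}$, the sequences of premises from which $B$ is derivable in $\mathcal{J}$ are exactly the sequences $\langle A^1_{j_1},\dots,A^p_{j_p}\rangle$ with $1\le j_i\le n_i$; that is, $\mathcal{J}$ is a complement of $\hat{\mathcal{I}}$.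
   Context: Consider a language with finitely many unary predicate symbols, finitely many unary function symbols, and a constant $\varepsilon$; write $a\,t$ for $a(t)$. Propositions are closed atomic propositions $P(t)$. Rules are schemata in one variable $x$: a schema with premises $A_1,\dots,A_n$ and conclusion $B$ means that for each closed term $t$, $B[t/x]$ is derivable from $\langle A_1[t/x],\dots,A_n[t/x]\rangle$. An Alternating pushdown system is an inference system whose rules are schemata of the following forms, all premises in a rule being distinct ($P_i,Q$ predicate symbols, $a$ a function symbol): intro: $P_1(x),\dots,P_n(x)$ / $Q(a\,x)$, $n\ge0$; elimination: $P_1(a\,x),P_2(x),\dots,P_n(x)$ / $Q(x)$, $n\ge1$; arbitrary: no premises / $Q(x)$; neutral: $P_1(x),\dots,P_n(x)$ / $Q(x)$, $n\ge1$; empty: no premises / $Q(\varepsilon)$. A system $\mathcal{J}$ is a complement of $\mathcal{I}$ when, for every proposition $B$, the sequences from which $B$ is derivable with a rule of $\mathcal{J}$ are exactly those obtained by picking one premise from each sequence from which $B$ is derivable with a rule of $\mathcal{I}$, as stated in the claim. -}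

module Defs where

open import Data.Nat using (ℕ)
open import Data.Fin using (Fin) renaming (_≟_ to _≟F_)
open import Data.List using (List; []; _∷_; map; concatMap; filter; allFin; [_])
open import Data.List.Membership.Propositional using (_∈_)
open import Data.List.Relation.Unary.All using (All)
open import Data.List.Relation.Unary.Unique.Propositional using (Unique)
open import Data.Product using (Σ; ∃; ∃-syntax; _×_; _,_)
open import Relation.Nullary using (¬_; Dec; yes; no)
open import Relation.Binary.PropositionalEquality using (_≡_; refl; cong; cong₂)

-- The language: nP unary predicate symbols, nF unary function symbols, constant ε.
module Lang (nP nF : ℕ) where

  data Term : Set where
    ε   : Term
    _·_ : Fin nF → Term → Term

  -- terms in the single schema variable x
  data OTerm : Set where
    var : OTerm
    eps : OTerm
    _·_ : Fin nF → OTerm → OTerm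

  data Atom : Set where
    at : Fin nP → Term → Atom

  data OAtom : Set where
    oat : Fin nP → OTerm → OAtom

  inst : OTerm → Term → Term
  inst var u     = u
  inst eps u     = ε
  inst (a · p) u = a · inst p u

  instA : OAtom → Term → Atom
  instA (oat P p) u = at P (inst p u)

  osub : OTerm → OTerm → OTerm
  osub var u     = u
  osub eps u     = eps
  osub (a · p) u = a · osub p u

  osubA : OAtom → OTerm → OAtom
  osubA (oat P p) u = oat P (osub p u)

  _≟T_ : (p q : OTerm) → Dec (p ≡ q)
  var ≟T var = yes refl
  var ≟T eps = no (λ ())
  var ≟T (_ · _) = no (λ ())
  eps ≟T var = no (λ ())
  eps ≟T eps = yes refl
  eps ≟T (_ · _) = no (λ ())
  (_ · _) ≟T var = no (λ ())
  (_ · _) ≟T eps = no (λ ())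
  (a · p) ≟T (b · q) with a ≟F b | p ≟T q
  ... | yes refl | yes refl = yes refl
  ... | no a≢b   | _        = no (λ { refl → a≢b refl })
  ... | yes _    | no p≢q   = no (λ { refl → p≢q refl })

  _≟A_ : (A B : OAtom) → Dec (A ≡ B)
  oat P p ≟A oat Q q with P ≟F Q | p ≟T q
  ... | yes refl | yes refl = yes refl
  ... | no P≢Q   | _        = no (λ { refl → P≢Q refl })
  ... | yes _    | no p≢q   = no (λ { refl → p≢q refl })

  record Rule : Set where
    constructor _⊢_
    field
      prems : List OAtom
      concl : OAtom
  open Rule public

  System : Set
  System = List Rule

  atX : Fin nP → OAtom
  atX P = oat P var

  data IsAPSForm : Rule → Set where
    intro     : (Ps : List (Fin nP)) (Q : Fin nP) (a : Fin nF) →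
                IsAPSForm (map atX Ps ⊢ oat Q (a · var))
    elim      : (P₁ : Fin nP) (a : Fin nF) (Ps : List (Fin nP)) (Q : Fin nP) →
                IsAPSForm ((oat P₁ (a · var) ∷ map atX Ps) ⊢ oat Q var)
    arbitrary : (Q : Fin nP) → IsAPSForm ([] ⊢ oat Q var)
    neutral   : (P₁ : Fin nP) (Ps : List (Fin nP)) (Q : Fin nP) →
                IsAPSForm (map atX (P₁ ∷ Ps) ⊢ oat Q var)
    empty     : (Q : Fin nP) → IsAPSForm ([] ⊢ oat Q eps)

  IsAPS : System → Set
  IsAPS I = All (λ r → IsAPSForm r × Unique (prems r)) I

  substR : Rule → OTerm → Rule
  substR (ps ⊢ c) u = map (λ A → osubA A u) ps ⊢ osubA c u

  hatRule : Rule → List Rule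
  hatRule (ps ⊢ oat Q var) =
    substR (ps ⊢ oat Q var) eps ∷ map (λ a → substR (ps ⊢ oat Q var) (a · var)) (allFin nF)
  hatRule (ps ⊢ oat Q eps) = [ ps ⊢ oat Q eps ]
  hatRule (ps ⊢ oat Q (a · p)) = [ ps ⊢ oat Q (a · p) ]

  hat : System → System
  hat I = concatMap hatRule I

  DerivWith : Rule → Atom → List Atom → Set
  DerivWith r B S = ∃[ t ] (instA (concl r) t ≡ B × map (λ A → instA A t) (prems r) ≡ S)

  Der : System → Atom → List Atom → Set
  Der J B S = ∃[ r ] (r ∈ J × DerivWith r B S)

  -- S is obtained by picking one premise from each sequence from which B is
  -- derivable with a rule of the given system (taken in the order of the rules)
  data Pick : System → Atom → List Atom → Set where
    nil  : ∀ {B} → Pick [] B []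
    skip : ∀ {r rs B S} → ¬ (∃[ T ] DerivWith r B T) → Pick rs B S → Pick (r ∷ rs) B S
    pick : ∀ {r rs B S T A} → DerivWith r B T → A ∈ T → Pick rs B S →
           Pick (r ∷ rs) B (A ∷ S)

  IsComplement : System → System → Set
  IsComplement I J = ∀ B S → (Der J B S → Pick I B S) × (Pick I B S → Der J B S)

  IsInstance : Atom → OAtom → Set
  IsInstance B c = ∃[ t ] instA c t ≡ B

  UniqueInstances : List OAtom → Set
  UniqueInstances C =
    ∀ B → ∃[ c ] (c ∈ C × IsInstance B c × (∀ c' → c' ∈ C → IsInstance B c' → c' ≡ c))

  choices : {A : Set} → List (List A) → List (List A)
  choices []         = [] ∷ []
  choices (l ∷ ls)   = concatMap (λ a → map (a ∷_) (choices ls)) l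

  Jsys : System → List OAtom → System
  Jsys Ih C = concatMap
    (λ c → map (λ ps → ps ⊢ c) (choices (map prems (filter (λ r → concl r ≟A c) Ih))))
    C

{-# OPTIONS --safe #-}
module Submission where

-- No conclusion of a rule of Î has the form P(x): it is P(ε), P(a x), or the
-- instance x := ε of a schema, whose premises are closed. So a closed instance
-- of the conclusion determines the instance of the premises. By uniqueness of
-- instances in 𝒞, the rules of Î deriving B are exactly those concluding the one
-- c ∈ 𝒞 matching B, all used at the same instance; the rules of 𝒥 concluding c
-- pick one premise from each of them.

open import Defs
open import Data.Nat using (ℕ)
open import Data.List using (List; []; _∷_; map; filter)
open import Data.List.Membership.Propositional using (_∈_; find; lose)
open import Data.List.Membership.Propositional.Properties
  using (∈-map⁺; ∈-map⁻; ∈-concatMap⁺; ∈-concatMap⁻; map∷⁻)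
open import Data.List.Relation.Unary.Any using (here; there)
open import Data.List.Relation.Unary.All as All using (All; []; _∷_)
open import Data.List.Relation.Binary.Pointwise using (Pointwise; []; _∷_)
open import Data.Product using (∃-syntax; _×_; _,_; proj₁)
open import Data.Empty using (⊥-elim)
open import Relation.Nullary using (yes; no)
open import Relation.Binary.PropositionalEquality using (_≡_; refl; cong; trans; sym)

module Complement (nP nF : ℕ) where
  open Lang nP nF

  ∈-choices⁺ : {A : Set} {xs : List A} {xss : List (List A)} →
               Pointwise _∈_ xs xss → xs ∈ choices xss
  ∈-choices⁺ []           = here refl
  ∈-choices⁺ (x∈ ∷ xs∈) = ∈-concatMap⁺ _ (lose x∈ (∈-map⁺ (_ ∷_) (∈-choices⁺ xs∈)))

  ∈-choices⁻ : {A : Set} {xs : List A} (xss : List (List A)) →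
               xs ∈ choices xss → Pointwise _∈_ xs xss
  ∈-choices⁻ []       (here refl) = []
  ∈-choices⁻ (l ∷ ls) xs∈
    with x , x∈l , xs∈′ ← find (∈-concatMap⁻ _ {xs = l} xs∈)
    with ys , ys∈ , refl ← map∷⁻ xs∈′
    = x∈l ∷ ∈-choices⁻ ls ys∈

  premisesConcluding : OAtom → System → List (List OAtom)
  premisesConcluding c L = map prems (filter (λ r → concl r ≟A c) L)

  ∈-Jsys⁺ : ∀ {L C c ps} → c ∈ C → ps ∈ choices (premisesConcluding c L) →
            (ps ⊢ c) ∈ Jsys L C
  ∈-Jsys⁺ c∈C ps∈ = ∈-concatMap⁺ _ (lose c∈C (∈-map⁺ (_⊢ _) ps∈))

  ∈-Jsys⁻ : ∀ {L C r} → r ∈ Jsys L C →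
            ∃[ c ] ∃[ ps ] (c ∈ C × ps ∈ choices (premisesConcluding c L) × r ≡ ps ⊢ c)
  ∈-Jsys⁻ {C = C} r∈
    with c , c∈C , r∈′ ← find (∈-concatMap⁻ _ {xs = C} r∈)
    with ps , ps∈ , refl ← ∈-map⁻ _ r∈′
    = c , ps , c∈C , ps∈ , refl

  ConclusionDeterminesPremises : Rule → Set
  ConclusionDeterminesPremises r = ∀ {t t′ A} →
    instA (concl r) t ≡ instA (concl r) t′ → A ∈ prems r → instA A t ≡ instA A t′

  inst-osub-eps : ∀ p t t′ → inst (osub p eps) t ≡ inst (osub p eps) t′
  inst-osub-eps var     t t′ = refl
  inst-osub-eps eps     t t′ = refl
  inst-osub-eps (a · p) t t′ = cong (a ·_) (inst-osub-eps p t t′)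

  eps-instance-determines : ∀ ps Q →
    ConclusionDeterminesPremises (substR (ps ⊢ oat Q var) eps)
  eps-instance-determines ps Q {t} {t′} _ A∈ with oat P p , _ , refl ← ∈-map⁻ _ A∈ =
    cong (at P) (inst-osub-eps p t t′)

  cons-conclusion-determines : ∀ ps Q a → ConclusionDeterminesPremises (ps ⊢ oat Q (a · var))
  cons-conclusion-determines ps Q a refl _ = refl

  hatRule-determines : ∀ {r r′} → IsAPSForm r → r′ ∈ hatRule r → ConclusionDeterminesPremises r′
  hatRule-determines {ps ⊢ oat Q var} _ (here refl) = eps-instance-determines ps Q
  hatRule-determines {ps ⊢ oat Q var} _ (there r′∈) with a , _ , refl ← ∈-map⁻ _ r′∈ =
    cons-conclusion-determines _ Q a
  hatRule-determines (empty Q)         (here refl) = λ _ ()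
  hatRule-determines (intro Ps Q a)    (here refl) = cons-conclusion-determines _ Q a

  hat-determines : ∀ {I} → IsAPS I → All ConclusionDeterminesPremises (hat I)
  hat-determines {I} aps = All.tabulate λ r∈
    → let r , r∈I , r∈hat = find (∈-concatMap⁻ hatRule {xs = I} r∈)
      in hatRule-determines (proj₁ (All.lookup aps r∈I)) r∈hat

  module _ {B : Atom} {c : OAtom} where

    MatchesOnlyAt : Rule → Set
    MatchesOnlyAt r = IsInstance B (concl r) → concl r ≡ c

    pick⁺ : ∀ {L t ps} → All MatchesOnlyAt L → instA c t ≡ B →
            Pointwise _∈_ ps (premisesConcluding c L) → Pick L B (map (λ A → instA A t) ps)
    pick⁺ {[]} [] _ [] = nil
    pick⁺ {r ∷ L} (only ∷ onlys) e ps∈ with concl r ≟A c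
    pick⁺ {r ∷ L} (only ∷ onlys) e (A∈ ∷ ps∈) | yes refl =
      pick (_ , e , refl) (∈-map⁺ _ A∈) (pick⁺ onlys e ps∈)
    ... | no r≢c = skip (λ (_ , t , e′ , _) → r≢c (only (t , e′))) (pick⁺ onlys e ps∈)

    pick⁻ : ∀ {L S t₀} → All MatchesOnlyAt L → All ConclusionDeterminesPremises L →
            instA c t₀ ≡ B → Pick L B S →
            ∃[ ps ] (Pointwise _∈_ ps (premisesConcluding c L) × map (λ A → instA A t₀) ps ≡ S)
    pick⁻ [] [] _ nil = [] , [] , refl
    pick⁻ {r ∷ L} (_ ∷ onlys) (_ ∷ dets) e₀ (skip underivable p) with concl r ≟A c
    ... | yes refl = ⊥-elim (underivable (_ , _ , e₀ , refl))
    ... | no _     = pick⁻ onlys dets e₀ p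
    pick⁻ {r ∷ L} (only ∷ onlys) (det ∷ dets) e₀ (pick (t , e , refl) A∈ p)
      with concl r ≟A c
    ... | no r≢c = ⊥-elim (r≢c (only (t , e)))
    ... | yes refl
      with a , a∈ , refl ← ∈-map⁻ _ A∈
      with ps , ps∈ , refl ← pick⁻ onlys dets e₀ p
      = a ∷ ps , a∈ ∷ ps∈ , cong (_∷ _) (sym (det (trans e (sym e₀)) a∈))

proposition10 : (nP nF : ℕ) → let open Lang nP nF in
    (I : System) → IsAPS I →
    (C : List OAtom) → (∀ r → r ∈ hat I → concl r ∈ C) → UniqueInstances C →
    IsComplement (hat I) (Jsys (hat I) C)
proposition10 nP nF I aps C concl∈C uniqueInstances B S
  with c , c∈C , (t₀ , e₀) , unique ← uniqueInstances B = derivable⇒pick , pick⇒derivable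
  where
  open Lang nP nF
  open Complement nP nF

  onlyAt-c : All MatchesOnlyAt (hat I)
  onlyAt-c = All.tabulate λ {r} r∈ → unique (concl r) (concl∈C r r∈)

  derivable⇒pick : Der (Jsys (hat I) C) B S → Pick (hat I) B S
  derivable⇒pick (r , r∈J , t , e , refl)
    with c′ , ps , c′∈C , ps∈ , refl ← ∈-Jsys⁻ {L = hat I} r∈J
    with refl ← unique c′ c′∈C (t , e)
    = pick⁺ onlyAt-c e (∈-choices⁻ _ ps∈)

  pick⇒derivable : Pick (hat I) B S → Der (Jsys (hat I) C) B S
  pick⇒derivable p with ps , ps∈ , eq ← pick⁻ onlyAt-c (hat-determines aps) e₀ p =
    ps ⊢ c , ∈-Jsys⁺ {L = hat I} c∈C (∈-choices⁺ ps∈) , t₀ , e₀ , eq
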